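{- Let $G$ be a connected graph with exactly one cycle $C$, of odd length. If there exists a vertex $u\in V(C)$ with $\ell_u\ge 1$, then there is an edge $e\in E(C)$ incident to $u$ such that $Z(G-e)\le Z(G)$.
   Context: For $u\in V(C)$, $T_u$ denotes the connected component containing $u$ of the graph $(V(G),E(G)\setminus E(C))$; it is a tree. If $T_u=\{u\}$ then $\ell_u=0$; otherwise $\ell_u$ is the terminal degree of $u$ in $G$, namely the number of degree-$1$ vertices $w$ of $G$ such that $d(w,u)<d(w,x)$ for every other vertex $x\neq u$ of degree at least $3$. $Z(G)$ is the zero forcing number: the minimum size of a set of initially black vertices such that repeatedly applying the rule "if a black vertex has exactly one white neighbor, that neighbor becomes black" eventually makes all vertices black. -}

module Defs where

open import Data.Nat using (ℕ; zero; suc; _≤_; _<_)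
open import Data.Bool using (Bool; true; false; if_then_else_; _∧_; _∨_)
open import Data.Fin using (Fin; _≟_)
open import Data.Fin.Subset using (Subset; inside; ⊤; ∣_∣) renaming (_∈_ to _∈ₛ_; _∉_ to _∉ₛ_)
open import Data.Vec using (tabulate; _[_]≔_)
open import Data.List using (List; []; _∷_; _++_; [_]; length)
open import Data.List.Relation.Unary.Unique.Propositional using (Unique)
open import Data.Product using (Σ; ∃; _×_; _,_)
open import Data.Sum using (_⊎_)
open import Relation.Binary.PropositionalEquality using (_≡_; _≢_)
open import Relation.Nullary using (¬_)
open import Relation.Nullary.Decidable using (⌊_⌋)

Graph : ℕ → Set
Graph n = Fin n → Fin n → Bool

IsSimple : ∀ {n} → Graph n → Set
IsSimple {n} G = (∀ (i j : Fin n) → G i j ≡ G j i) × (∀ (i : Fin n) → G i i ≡ false)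

E : ∀ {n} → Graph n → Fin n → Fin n → Set
E G a b = G a b ≡ true

data Walk {n : ℕ} (R : Fin n → Fin n → Set) : Fin n → Fin n → ℕ → Set where
  stop : ∀ {a} → Walk R a a zero
  step : ∀ {a b c d} → R a b → Walk R b c d → Walk R a c (suc d)

Connected : ∀ {n} → Graph n → Set
Connected {n} G = ∀ (a b : Fin n) → ∃ λ d → Walk (E G) a b d

Dist : ∀ {n} → Graph n → Fin n → Fin n → ℕ → Set
Dist G a b d = Walk (E G) a b d × (∀ d' → Walk (E G) a b d' → d ≤ d')

deg : ∀ {n} → Graph n → Fin n → ℕ
deg G v = ∣ tabulate (G v) ∣

data Consec {A : Set} : List A → A → A → Set where
  here  : ∀ {x y xs} → Consec (x ∷ y ∷ xs) x y
  there : ∀ {x xs a b} → Consec xs a b → Consec (x ∷ xs) a b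

-- a cycle c0 c1 ... c(k-1) is given by its list of vertices; closed adds c0 at the end
closed : ∀ {A : Set} → List A → List A
closed [] = []
closed (x ∷ xs) = x ∷ (xs ++ [ x ])

CycEdge : ∀ {n} → List (Fin n) → Fin n → Fin n → Set
CycEdge C a b = Consec (closed C) a b ⊎ Consec (closed C) b a

IsCycle : ∀ {n} → Graph n → List (Fin n) → Set
IsCycle G C = (3 ≤ length C) × Unique C × (∀ a b → Consec (closed C) a b → E G a b)

-- two cycles are the same cycle (same subgraph) iff they have the same edge set
SameCycle : ∀ {n} → List (Fin n) → List (Fin n) → Set
SameCycle C D = ∀ a b → (CycEdge C a b → CycEdge D a b) × (CycEdge D a b → CycEdge C a b)

UniqueCycle : ∀ {n} → Graph n → List (Fin n) → Set
UniqueCycle G C = IsCycle G C × (∀ D → IsCycle G D → SameCycle C D)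

deleteEdge : ∀ {n} → Graph n → Fin n → Fin n → Graph n
deleteEdge G a b i j =
  if (⌊ i ≟ a ⌋ ∧ ⌊ j ≟ b ⌋) ∨ (⌊ i ≟ b ⌋ ∧ ⌊ j ≟ a ⌋) then false else G i j

EOffC : ∀ {n} → Graph n → List (Fin n) → Fin n → Fin n → Set
EOffC G C a b = E G a b × ¬ CycEdge C a b

-- v lies in T_u, the component of u in (V(G), E(G) \ E(C))
InT : ∀ {n} → Graph n → List (Fin n) → Fin n → Fin n → Set
InT G C u v = ∃ λ d → Walk (EOffC G C) u v d

-- w is counted by the terminal degree of u: deg w = 1 and d(w,u) < d(w,x)
-- for every vertex x ≠ u of degree ≥ 3
Terminal : ∀ {n} → Graph n → Fin n → Fin n → Set
Terminal {n} G u w =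
  deg G w ≡ 1 ×
  (∀ (x : Fin n) → x ≢ u → 3 ≤ deg G x →
     ∀ d₁ d₂ → Dist G w u d₁ → Dist G w x d₂ → d₁ < d₂)

-- ℓ_u ≥ 1 : T_u ≠ {u} (so ℓ_u is the terminal degree) and this count is ≥ 1
ℓ≥1 : ∀ {n} → Graph n → List (Fin n) → Fin n → Set
ℓ≥1 G C u = (∃ λ v → v ≢ u × InT G C u v) × (∃ λ w → Terminal G u w)

-- zero forcing: sets of black vertices obtainable from S by the colour change rule
data Derivable {n : ℕ} (G : Graph n) (S : Subset n) : Subset n → Set where
  init  : Derivable G S S
  force : ∀ {B} (b w : Fin n) → Derivable G S B → b ∈ₛ B → w ∉ₛ B → E G b w →
          (∀ x → E G b x → x ≢ w → x ∈ₛ B) → Derivable G S (B [ w ]≔ inside)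

ZeroForcing : ∀ {n} → Graph n → Subset n → Set
ZeroForcing G S = Derivable G S ⊤

IsZ : ∀ {n} → Graph n → ℕ → Set
IsZ {n} G k = (∃ λ (S : Subset n) → ZeroForcing G S × ∣ S ∣ ≡ k)
            × (∀ S → ZeroForcing G S → k ≤ ∣ S ∣)

-- Let w be a leaf counted by ℓ_u. On a shortest w–u path every inner vertex has degree 2, since
-- a vertex of degree ≥ 3 there would be closer to w than u; so the path is a leg of G hanging at u,
-- disjoint from the cycle. Fix a minimum zero forcing set S₀ with a forcing chronology and let a, b be
-- the cycle neighbours of u. If u forces the leg vertex next to it, u forces neither a nor b, and at
-- most one of a, b forces u; the chronology stays valid after deleting the edge from u to the other.
-- Otherwise some leg vertex lies in S₀: moving it to the leaf, in G − uv the leaf forces the whole leg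
-- and u, and then the chronology of S₀ replays, where v ∈ {a, b} is chosen not to be forced by u.

module Submission where

open import Data.Bool using (true; false; _∧_; _∨_)
import Data.Bool as Bool
open import Data.Empty using (⊥; ⊥-elim)
open import Data.Fin using (Fin; zero; suc; _≟_)
open import Data.Fin.Properties using (any?; all?)
open import Data.Fin.Subset
  using (Subset; inside; outside; ⊤; _-_; _⊆_; _⊂_; ∣_∣)
  renaming (_∈_ to _∈ₛ_; _∉_ to _∉ₛ_)
open import Data.Fin.Subset.Properties
  using (_∈?_; ∈⊤; ⊆⊤; ⊆-antisym; anySubset?; ∣p∣≤n; ∣⊤∣≡n; p⊂q⇒∣p∣<∣q∣; x∈p⇒∣p-x∣<∣p∣; x∈p∧x≢y⇒x∈p-y)
open import Data.List using (List; []; _∷_; _++_; [_]; length)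
open import Data.List.Properties using (++-assoc)
open import Data.List.Membership.Propositional using (_∈_; _∉_)
open import Data.List.Membership.Propositional.Properties using (∈-++⁺ˡ; ∈-++⁺ʳ; ∈-++⁻; ∈-∃++)
open import Data.List.Relation.Unary.Any using (here; there)
import Data.List.Relation.Unary.All as All
open import Data.List.Relation.Unary.AllPairs using (_∷_)
open import Data.List.Relation.Unary.Unique.Propositional using (Unique)
open import Data.Nat using (ℕ; zero; suc; _+_; _≤_; _<_; _%_; z≤n; s≤s)
import Data.Nat as ℕ
open import Data.Nat.Properties
  using (≤-refl; ≤-reflexive; ≤-trans; m≤m+n; <⇒≤; +-monoʳ-≤; n≤1+n; ≤-pred; ≰⇒>; <⇒≱; m≤n⇒m<n∨m≡n; +-suc)
open import Data.Product using (Σ; ∃; ∃₂; _×_; _,_; proj₁; proj₂)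
import Data.Product
open import Data.Sum using (_⊎_; inj₁; inj₂)
import Data.Sum
open import Data.Vec using (_∷_; tabulate; lookup; _[_]≔_)
open import Data.Vec.Properties using ([]=⇒lookup; lookup⇒[]=; lookup∘tabulate; []≔-updates; []≔-minimal; lookup∘update′)
open import Relation.Binary.PropositionalEquality using (_≡_; _≢_; refl; sym; trans; subst)
open import Relation.Nullary using (¬_; Dec; yes; no)
open import Relation.Nullary.Decidable using (decidable-stable; _⊎-dec_; map′; ⌊_⌋; _×-dec_; _→-dec_; ¬?)
open import Relation.Unary using (Decidable)
open import Function using (case_of_; _∘_)

open import Defs

least : ∀ {P : ℕ → Set} → Decidable P → ∀ {m} → P m → ∃ λ k → P k × (∀ j → P j → k ≤ j)
least {P} P? {m} pm with search m
  where
  search : ∀ m → (∃ λ k → P k × (∀ j → P j → k ≤ j)) ⊎ (∀ j → j ≤ m → ¬ P j)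
  search zero with P? zero
  ... | yes p = inj₁ (zero , p , λ _ _ → z≤n)
  ... | no ¬p = inj₂ λ { zero _ → ¬p }
  search (suc m) with search m
  ... | inj₁ found = inj₁ found
  ... | inj₂ none with P? (suc m)
  ...   | yes p = inj₁ (suc m , p , λ j pj → ≰⇒> (λ j≤m → none j j≤m pj))
  ...   | no ¬p = inj₂ λ j j≤1+m pj → case m≤n⇒m<n∨m≡n j≤1+m of λ where
            (inj₁ j<1+m) → none j (≤-pred j<1+m) pj
            (inj₂ refl) → ¬p pj
... | inj₁ found = found
... | inj₂ none = ⊥-elim (none m ≤-refl pm)

one-of-two : ∀ {A : Set} {P : A → Set} {a b} → a ≢ b → (P a → P b → a ≡ b) → Dec (P a) →
             ∃ λ v → (v ≡ a ⊎ v ≡ b) × ¬ P v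
one-of-two a≢b unique (yes pa) = _ , inj₂ refl , λ pb → a≢b (unique pa pb)
one-of-two a≢b unique (no ¬pa) = _ , inj₁ refl , ¬pa

∉⇒≢ : ∀ {A : Set} {xs : List A} {x y} → x ∉ xs → y ∈ xs → x ≢ y
∉⇒≢ x∉ y∈ refl = x∉ y∈

module _ {A : Set} where

  consec-mid : ∀ (X : List A) {a b Y} → Consec (X ++ a ∷ b ∷ Y) a b
  consec-mid [] = here
  consec-mid (_ ∷ X) = there (consec-mid X)

  consec-∈ : ∀ {L : List A} {a b} → Consec L a b → a ∈ L × b ∈ L
  consec-∈ here = here refl , there (here refl)
  consec-∈ (there c) = Data.Product.map there there (consec-∈ c)

  closed-∈ : ∀ {C : List A} {x} → x ∈ closed C → x ∈ C
  closed-∈ {_ ∷ _} (here x≡y) = here x≡y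
  closed-∈ {_ ∷ C} (there x∈) with ∈-++⁻ C x∈
  ... | inj₁ x∈C = there x∈C
  ... | inj₂ (here x≡y) = here x≡y

  lastOf : A → List A → A
  lastOf x [] = x
  lastOf _ (y ∷ L) = lastOf y L

  lastOf-∈ : ∀ x L → lastOf x L ∈ x ∷ L
  lastOf-∈ x [] = here refl
  lastOf-∈ _ (y ∷ L) = there (lastOf-∈ y L)

  consec-lastOf : ∀ x L {c R} → Consec (x ∷ L ++ c ∷ R) (lastOf x L) c
  consec-lastOf x [] = here
  consec-lastOf _ (y ∷ L) = there (consec-lastOf y L)

  unique-++-disjoint : ∀ (X : List A) {Y a b} → Unique (X ++ Y) → a ∈ X → b ∈ Y → a ≢ b
  unique-++-disjoint (_ ∷ X) (x∉ ∷ _) (here refl) b∈Y = All.lookup x∉ (∈-++⁺ʳ X b∈Y)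
  unique-++-disjoint (_ ∷ X) (_ ∷ u) (there a∈X) b∈Y = unique-++-disjoint X u a∈X b∈Y

module _ {n} {B : Subset n} where

  ∈-insert⁺ : ∀ {x} w → x ∈ₛ B → x ∈ₛ B [ w ]≔ inside
  ∈-insert⁺ {x} w x∈B with x ≟ w
  ... | yes refl = []≔-updates B w
  ... | no x≢w = []≔-minimal B x w x≢w x∈B

  ∈-insert⁻ : ∀ {x} w → x ∈ₛ B [ w ]≔ inside → x ≡ w ⊎ x ∈ₛ B
  ∈-insert⁻ {x} w x∈B' with x ≟ w
  ... | yes x≡w = inj₁ x≡w
  ... | no x≢w = inj₂ (lookup⇒[]= x B (trans (sym (lookup∘update′ x≢w B inside)) ([]=⇒lookup x∈B')))

  insert-⊆ : ∀ {w B'} → B ⊆ B' → w ∈ₛ B' → B [ w ]≔ inside ⊆ B'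
  insert-⊆ {w} B⊆B' w∈B' x∈ with ∈-insert⁻ w x∈
  ... | inj₁ refl = w∈B'
  ... | inj₂ x∈B = B⊆B' x∈B

  ⊂-insert : ∀ {w} → w ∉ₛ B → B ⊂ B [ w ]≔ inside
  ⊂-insert {w} w∉B = ∈-insert⁺ w , w , []≔-updates B w , w∉B

∣insert∣≤1+∣p∣ : ∀ {n} (B : Subset n) w → ∣ B [ w ]≔ inside ∣ ≤ suc ∣ B ∣
∣insert∣≤1+∣p∣ (inside ∷ B) zero = n≤1+n _
∣insert∣≤1+∣p∣ (outside ∷ B) zero = ≤-refl
∣insert∣≤1+∣p∣ (inside ∷ B) (suc w) = s≤s (∣insert∣≤1+∣p∣ B w)
∣insert∣≤1+∣p∣ (outside ∷ B) (suc w) = ∣insert∣≤1+∣p∣ B w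

x∈p⇒0<∣p∣ : ∀ {n} {p : Subset n} {x} → x ∈ₛ p → 0 < ∣ p ∣
x∈p⇒0<∣p∣ x∈p = ≤-trans (s≤s z≤n) (x∈p⇒∣p-x∣<∣p∣ x∈p)

k<∣p-x∣⇒1+k<∣p∣ : ∀ {n} {p : Subset n} {x k} → x ∈ₛ p → k < ∣ p - x ∣ → suc k < ∣ p ∣
k<∣p-x∣⇒1+k<∣p∣ x∈p k<∣p-x∣ = ≤-trans (s≤s k<∣p-x∣) (x∈p⇒∣p-x∣<∣p∣ x∈p)

module _ {n} {p : Subset n} where

  ∣p∣≤1⇒x≡y : ∣ p ∣ ≤ 1 → ∀ {x y} → x ∈ₛ p → y ∈ₛ p → x ≡ y
  ∣p∣≤1⇒x≡y ∣p∣≤1 {x} {y} x∈p y∈p with x ≟ y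
  ... | yes x≡y = x≡y
  ... | no x≢y = ⊥-elim (<⇒≱ (k<∣p-x∣⇒1+k<∣p∣ x∈p (x∈p⇒0<∣p∣ (x∈p∧x≢y⇒x∈p-y y∈p (x≢y ∘ sym)))) ∣p∣≤1)

  ∣p∣≤2⇒z≡x∨z≡y : ∣ p ∣ ≤ 2 → ∀ {x y z} → x ∈ₛ p → y ∈ₛ p → x ≢ y → z ∈ₛ p → z ≡ x ⊎ z ≡ y
  ∣p∣≤2⇒z≡x∨z≡y ∣p∣≤2 {x} {y} {z} x∈p y∈p x≢y z∈p with z ≟ x | z ≟ y
  ... | yes z≡x | _ = inj₁ z≡x
  ... | _ | yes z≡y = inj₂ z≡y
  ... | no z≢x | no z≢y = ⊥-elim (<⇒≱ three ∣p∣≤2)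
    where
    y∈p-x = x∈p∧x≢y⇒x∈p-y y∈p (x≢y ∘ sym)
    z∈p-x-y = x∈p∧x≢y⇒x∈p-y (x∈p∧x≢y⇒x∈p-y z∈p z≢x) z≢y
    three : 2 < ∣ p ∣
    three = k<∣p-x∣⇒1+k<∣p∣ x∈p (k<∣p-x∣⇒1+k<∣p∣ y∈p-x (x∈p⇒0<∣p∣ z∈p-x-y))

module _ {n} (G : Graph n) where

  E⇒∈neighbourhood : ∀ {v x} → E G v x → x ∈ₛ tabulate (G v)
  E⇒∈neighbourhood {v} {x} e = lookup⇒[]= x _ (trans (lookup∘tabulate (G v) x) e)

  deg≤1⇒unique-neighbour : ∀ {v x y} → deg G v ≤ 1 → E G v x → E G v y → x ≡ y
  deg≤1⇒unique-neighbour d≤1 ex ey = ∣p∣≤1⇒x≡y d≤1 (E⇒∈neighbourhood ex) (E⇒∈neighbourhood ey)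

  deg≤2⇒two-neighbours : ∀ {v x y z} → deg G v ≤ 2 → E G v x → E G v y → x ≢ y →
                         E G v z → z ≡ x ⊎ z ≡ y
  deg≤2⇒two-neighbours d≤2 ex ey x≢y ez = ∣p∣≤2⇒z≡x∨z≡y d≤2 (E⇒∈neighbourhood ex) (E⇒∈neighbourhood ey) x≢y (E⇒∈neighbourhood ez)

E-sym : ∀ {n} {G : Graph n} → IsSimple G → ∀ {x y} → E G x y → E G y x
E-sym (sym-G , _) {x} {y} e = trans (sym-G y x) e

module _ {n} (G : Graph n) (u v : Fin n) where

  deleteEdge-⊆ : ∀ {x y} → E (deleteEdge G u v) x y → E G x y
  deleteEdge-⊆ {x} {y} e
    with (⌊ x ≟ u ⌋ ∧ ⌊ y ≟ v ⌋) ∨ (⌊ x ≟ v ⌋ ∧ ⌊ y ≟ u ⌋)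
  ... | false = e

  deleteEdge-keeps : ∀ {x y} → E G x y → ¬ (x ≡ u × y ≡ v) → ¬ (x ≡ v × y ≡ u) →
                     E (deleteEdge G u v) x y
  deleteEdge-keeps {x} {y} e ¬uv ¬vu with x ≟ u | y ≟ v | x ≟ v | y ≟ u
  ... | yes p | yes q | _     | _     = ⊥-elim (¬uv (p , q))
  ... | _     | _     | yes p | yes q = ⊥-elim (¬vu (p , q))
  ... | no _  | _     | no _  | _     = e
  ... | no _  | _     | yes _ | no _  = e
  ... | yes _ | no _  | no _  | _     = e
  ... | yes _ | no _  | yes _ | no _  = e

module _ {n} (G : Graph n) where

  walk? : ∀ d a b → Dec (Walk (E G) a b d)
  walk? zero a b = map′ (λ { refl → stop }) (λ { stop → refl }) (a ≟ b)
  walk? (suc d) a b =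
    map′ (λ { (c , e , W) → step e W }) (λ { (step e W) → _ , e , W })
         (any? λ c → (G a c Bool.≟ true) ×-dec walk? d c b)

  dist : ∀ {a b d} → Walk (E G) a b d → ∃ (Dist G a b)
  dist W = least (λ d → walk? d _ _) W

module _ {n} {R : Fin n → Fin n → Set} where

  vertexAt : ∀ {a b d} → Walk R a b d → ℕ → Fin n
  vertexAt {a} _ zero = a
  vertexAt {a} stop (suc _) = a
  vertexAt (step _ W) (suc j) = vertexAt W j

  vertexAt-last : ∀ {a b d} (W : Walk R a b d) → vertexAt W d ≡ b
  vertexAt-last stop = refl
  vertexAt-last (step _ W) = vertexAt-last W

  vertexAt-edge : ∀ {a b d} (W : Walk R a b d) {j} → j < d → R (vertexAt W j) (vertexAt W (suc j))
  vertexAt-edge (step e W) {zero} _ = e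
  vertexAt-edge (step e W) {suc j} (s≤s j<d) = vertexAt-edge W j<d

  prefix : ∀ {a b d} (W : Walk R a b d) {j} → j ≤ d → Walk R a (vertexAt W j) j
  prefix W {zero} _ = stop
  prefix (step e W) {suc j} (s≤s j≤d) = step e (prefix W j≤d)

  shortcut : ∀ {a b d} (W : Walk R a b d) {j} → suc (suc j) ≤ d →
             vertexAt W j ≡ vertexAt W (suc (suc j)) → ∃ λ d' → d' < d × Walk R a b d'
  shortcut (step _ (step _ W)) {zero} _ a≡c = _ , n≤1+n _ , subst (λ x → Walk R x _ _) (sym a≡c) W
  shortcut (step e W) {suc j} (s≤s j+2≤d) eq with shortcut W j+2≤d eq
  ... | d' , d'<d , W' = suc d' , s≤s d'<d , step e W'

module _ {n} {R : Fin n → Fin n → Set} {a b d} (W : Walk R a b d)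
         (shortest : ∀ d' → Walk R a b d' → d ≤ d') where

  geodesic-avoids-end : ∀ {j} → j < d → vertexAt W j ≢ b
  geodesic-avoids-end j<d eq = <⇒≱ j<d (shortest _ (subst (λ x → Walk R a x _) eq (prefix W (<⇒≤ j<d))))

  geodesic-no-return : ∀ {j} → suc (suc j) ≤ d → vertexAt W j ≢ vertexAt W (suc (suc j))
  geodesic-no-return j+2≤d eq with shortcut W j+2≤d eq
  ... | d' , d'<d , W' = <⇒≱ d'<d (shortest d' W')

cycle-neighbours : ∀ {n} {C : List (Fin n)} → 3 ≤ length C → Unique C → ∀ {c} → c ∈ C →
                   ∃₂ λ p s → p ≢ s × CycEdge C c p × CycEdge C c s
cycle-neighbours _ _ c∈C with ∈-∃++ c∈C
cycle-neighbours _ uniq {c} _ | [] , y ∷ z ∷ R , refl =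
  lastOf z R , y , (unique-++-disjoint (c ∷ y ∷ []) uniq (there (here refl)) (lastOf-∈ z R) ∘ sym) ,
  inj₂ (there (there (consec-lastOf z R))) , inj₁ here
cycle-neighbours _ uniq {c} _ | x ∷ L , s ∷ R , refl
  rewrite ++-assoc L (c ∷ s ∷ R) [ x ] =
  lastOf x L , s , unique-++-disjoint (x ∷ L) uniq (lastOf-∈ x L) (there (here refl)) ,
  inj₂ (consec-lastOf x L) , inj₁ (consec-mid (x ∷ L))
cycle-neighbours _ uniq {c} _ | x ∷ y ∷ L , [] , refl
  rewrite ++-assoc L (c ∷ []) [ x ] =
  lastOf y L , x , (unique-++-disjoint [ x ] uniq (here refl) (∈-++⁺ˡ (lastOf-∈ y L)) ∘ sym) ,
  inj₂ (consec-lastOf x (y ∷ L)) , inj₁ (consec-mid (x ∷ y ∷ L))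
cycle-neighbours (s≤s ()) _ _ | [] , [] , refl
cycle-neighbours (s≤s (s≤s ())) _ _ | [] , _ ∷ [] , refl
cycle-neighbours (s≤s (s≤s ())) _ _ | _ ∷ [] , [] , refl

cycEdge-∈ : ∀ {n} {C : List (Fin n)} {a b} → CycEdge C a b → b ∈ C
cycEdge-∈ (inj₁ c) = closed-∈ (proj₂ (consec-∈ c))
cycEdge-∈ (inj₂ c) = closed-∈ (proj₁ (consec-∈ c))

module _ {n} {G : Graph n} {C : List (Fin n)} where

  cycEdge⇒E : IsSimple G → IsCycle G C → ∀ {a b} → CycEdge C a b → E G a b
  cycEdge⇒E _ (_ , _ , on-C) (inj₁ c) = on-C _ _ c
  cycEdge⇒E simple (_ , _ , on-C) (inj₂ c) = E-sym simple (on-C _ _ c)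

  cycle-minDeg2 : IsSimple G → IsCycle G C → ∀ {c} → c ∈ C →
                  ∃₂ λ c₁ c₂ → c₁ ≢ c₂ × E G c c₁ × E G c c₂ × c₁ ∈ C × c₂ ∈ C
  cycle-minDeg2 simple cycle@(3≤ , uniq , _) c∈C with cycle-neighbours 3≤ uniq c∈C
  ... | p , s , p≢s , cp , cs =
    p , s , p≢s , cycEdge⇒E simple cycle cp , cycEdge⇒E simple cycle cs , cycEdge-∈ cp , cycEdge-∈ cs

module _ {n} {G : Graph n} {S : Subset n} where

  derivable-⊇ : ∀ {B} → Derivable G S B → S ⊆ B
  derivable-⊇ init x∈S = x∈S
  derivable-⊇ (force _ w D _ _ _ _) x∈S = ∈-insert⁺ w (derivable-⊇ D x∈S)

  Forces : ∀ {B} → Derivable G S B → Fin n → Fin n → Set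
  Forces init _ _ = ⊥
  Forces (force b w D _ _ _ _) x y = (x ≡ b × y ≡ w) ⊎ Forces D x y

  forces? : ∀ {B} (D : Derivable G S B) x y → Dec (Forces D x y)
  forces? init _ _ = no λ ()
  forces? (force b w D _ _ _ _) x y = ((x ≟ b) ×-dec (y ≟ w)) ⊎-dec forces? D x y

  forced-∈ : ∀ {B} (D : Derivable G S B) {x y} → Forces D x y → y ∈ₛ B
  forced-∈ (force _ w D _ _ _ _) (inj₁ (_ , refl)) = []≔-updates _ w
  forced-∈ (force _ w D _ _ _ _) (inj₂ f) = ∈-insert⁺ w (forced-∈ D f)

  forcer-nbhd-∈ : ∀ {B} (D : Derivable G S B) {x y z} → Forces D x y → E G x z → z ∈ₛ B
  forcer-nbhd-∈ (force _ w D _ _ _ rest) {z = z} (inj₁ (refl , refl)) e with z ≟ w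
  ... | yes refl = []≔-updates _ w
  ... | no z≢w = ∈-insert⁺ w (rest z e z≢w)
  forcer-nbhd-∈ (force _ w D _ _ _ _) (inj₂ f) e = ∈-insert⁺ w (forcer-nbhd-∈ D f e)

  -- Once x has forced, all its neighbours are black, so it can never force again.
  forces-functional : ∀ {B} (D : Derivable G S B) {x y y'} → Forces D x y → Forces D x y' → y ≡ y'
  forces-functional (force _ _ D _ _ _ _) (inj₁ (_ , refl)) (inj₁ (_ , refl)) = refl
  forces-functional (force _ _ D _ w∉ e _) (inj₁ (refl , refl)) (inj₂ f') = ⊥-elim (w∉ (forcer-nbhd-∈ D f' e))
  forces-functional (force _ _ D _ w∉ e _) (inj₂ f) (inj₁ (refl , refl)) = ⊥-elim (w∉ (forcer-nbhd-∈ D f e))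
  forces-functional (force _ _ D _ _ _ _) (inj₂ f) (inj₂ f') = forces-functional D f f'

  forces-injective : ∀ {B} (D : Derivable G S B) {x x' y} → Forces D x y → Forces D x' y → x ≡ x'
  forces-injective (force _ _ D _ _ _ _) (inj₁ (refl , _)) (inj₁ (refl , _)) = refl
  forces-injective (force _ _ D _ w∉ _ _) (inj₁ (_ , refl)) (inj₂ f') = ⊥-elim (w∉ (forced-∈ D f'))
  forces-injective (force _ _ D _ w∉ _ _) (inj₂ f) (inj₁ (_ , refl)) = ⊥-elim (w∉ (forced-∈ D f))
  forces-injective (force _ _ D _ _ _ _) (inj₂ f) (inj₂ f') = forces-injective D f f'

module _ {n} (G : Graph n) (u v : Fin n) {S S' B₀ : Subset n}
         (D₀ : Derivable (deleteEdge G u v) S' B₀) (S⊆B₀ : S ⊆ B₀) where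

  simulate-deleteEdge : ∀ {B} (D : Derivable G S B) → ¬ Forces D u v → (Forces D v u → u ∈ₛ B₀) →
                        ∃ λ B' → Derivable (deleteEdge G u v) S' B' × B ⊆ B' × B₀ ⊆ B'
  simulate-deleteEdge init _ _ = B₀ , D₀ , S⊆B₀ , λ x∈ → x∈
  simulate-deleteEdge (force b w D b∈ _ e rest) ¬uv vu⇒u∈
    with simulate-deleteEdge D (¬uv ∘ inj₂) (vu⇒u∈ ∘ inj₂)
  ... | B' , D' , B⊆B' , B₀⊆B' with w ∈? B'
  ...   | yes w∈B' = B' , D' , insert-⊆ B⊆B' w∈B' , B₀⊆B'
  ...   | no w∉B' =
    B' [ w ]≔ inside , force b w D' (B⊆B' b∈) w∉B' e' rest' ,
    insert-⊆ (∈-insert⁺ w ∘ B⊆B') ([]≔-updates B' w) , ∈-insert⁺ w ∘ B₀⊆B'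
    where
    e' : E (deleteEdge G u v) b w
    e' = deleteEdge-keeps G u v e (λ { (refl , refl) → ¬uv (inj₁ (refl , refl)) })
                                  (λ { (refl , refl) → w∉B' (B₀⊆B' (vu⇒u∈ (inj₁ (refl , refl)))) })
    rest' : ∀ x → E (deleteEdge G u v) b x → x ≢ w → x ∈ₛ B'
    rest' x ex x≢w = B⊆B' (rest x (deleteEdge-⊆ G u v ex) x≢w)

  deleteEdge-zeroForcing : (D : ZeroForcing G S) → ¬ Forces D u v → (Forces D v u → u ∈ₛ B₀) →
                           ZeroForcing (deleteEdge G u v) S'
  deleteEdge-zeroForcing D ¬uv vu⇒u∈ with simulate-deleteEdge D ¬uv vu⇒u∈
  ... | B' , D' , ⊤⊆B' , _ = subst (Derivable _ S') (⊆-antisym ⊆⊤ ⊤⊆B') D'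

module _ {n} (G : Graph n) where

  CanForce : Subset n → Fin n → Fin n → Set
  CanForce B b w = b ∈ₛ B × w ∉ₛ B × E G b w × (∀ x → E G b x → x ≢ w → x ∈ₛ B)

  canForce? : ∀ B b w → Dec (CanForce B b w)
  canForce? B b w =
    (b ∈? B) ×-dec ¬? (w ∈? B) ×-dec (G b w Bool.≟ true) ×-dec
    all? (λ x → (G b x Bool.≟ true) →-dec ¬? (x ≟ w) →-dec (x ∈? B))

  Stalled : Subset n → Set
  Stalled B = ∀ b w → ¬ CanForce B b w

  module _ {S : Subset n} where

    derive-stalled : ∃ λ B → Derivable G S B × Stalled B
    derive-stalled = go n init (m≤m+n n ∣ S ∣)
      where
      go : ∀ fuel {B} → Derivable G S B → n ≤ fuel + ∣ B ∣ → ∃ λ B → Derivable G S B × Stalled B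
      go fuel {B} D n≤ with any? (λ b → any? (canForce? B b))
      ... | no none = B , D , λ b w c → none (b , w , c)
      ... | yes (b , w , b∈ , w∉ , e , rest) = continue fuel n≤
        where
        grows : ∣ B ∣ < ∣ B [ w ]≔ inside ∣
        grows = p⊂q⇒∣p∣<∣q∣ (⊂-insert w∉)
        continue : ∀ fuel → n ≤ fuel + ∣ B ∣ → ∃ λ B → Derivable G S B × Stalled B
        continue zero n≤ = ⊥-elim (<⇒≱ grows (≤-trans (∣p∣≤n (B [ w ]≔ inside)) n≤))
        continue (suc f) n≤ =
          go f (force b w D b∈ w∉ e rest) (≤-trans n≤ (subst (_≤ f + ∣ B [ w ]≔ inside ∣) (+-suc f ∣ B ∣) (+-monoʳ-≤ f grows)))

    stalled-⊇ : ∀ {B'} → Stalled B' → S ⊆ B' → ∀ {B} → Derivable G S B → B ⊆ B'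
    stalled-⊇ _ S⊆B' init = S⊆B'
    stalled-⊇ {B'} stalled S⊆B' (force b w D b∈ _ e rest) =
      insert-⊆ B⊆B' (decidable-stable (w ∈? B') λ w∉B' →
        stalled b w (B⊆B' b∈ , w∉B' , e , λ y ey y≢w → B⊆B' (rest y ey y≢w)))
      where B⊆B' = stalled-⊇ stalled S⊆B' D

  zeroForcing? : ∀ S → Dec (ZeroForcing G S)
  zeroForcing? S with derive-stalled {S}
  ... | B , D , stalled with all? (_∈? B)
  ...   | yes all∈B = yes (subst (Derivable G S) (⊆-antisym ⊆⊤ λ {x} _ → all∈B x) D)
  ...   | no ¬all∈B = no λ Z → ¬all∈B λ x → stalled-⊇ stalled (derivable-⊇ D) Z ∈⊤

  Z-exists : ∃ (IsZ G)
  Z-exists with least (λ k → anySubset? (λ S → zeroForcing? S ×-dec (∣ S ∣ ℕ.≟ k))) (⊤ , init , ∣⊤∣≡n n)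
  ... | k , Sₖ , minimal = k , Sₖ , λ S Z → minimal ∣ S ∣ (S , Z , refl)

record Leg {n} (G : Graph n) (u : Fin n) (m : ℕ) : Set where
  field
    vertex : ℕ → Fin n
    end    : vertex (suc m) ≡ u
    edge   : ∀ {j} → j ≤ m → E G (vertex j) (vertex (suc j))
    nbhd   : ∀ {j} → j ≤ m → ∀ {z} → E G (vertex j) z →
             z ≡ vertex (suc j) ⊎ ∃ λ t → j ≡ suc t × z ≡ vertex t

open Leg

terminal-leg : ∀ {n} {G : Graph n} {u w} → IsSimple G → Terminal G u w → w ≢ u →
               ∀ {d} → Walk (E G) w u d → ∃ (Leg G u)
terminal-leg {G = G} {u} {w} simple (deg-w , closest) w≢u W₀ with dist G W₀
... | zero , stop , _ = ⊥-elim (w≢u refl)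
... | suc m , W , shortest = m , leg
  where
  q = vertexAt W

  -- A vertex of degree ≥ 3 inside the geodesic would be strictly closer to w than u is.
  inner-deg≤2 : ∀ {j} → suc j ≤ m → deg G (q (suc j)) ≤ 2
  inner-deg≤2 {j} j<m = ≤-pred (≰⇒> λ 3≤deg →
    <⇒≱ (closest x (geodesic-avoids-end W shortest (s≤s j<m)) 3≤deg _ _ (W , shortest) (proj₂ Dₓ))
        (≤-trans (proj₂ (proj₂ Dₓ) _ Wₓ) (≤-trans j<m (n≤1+n m))))
    where
    x = q (suc j)
    Wₓ : Walk (E G) w x (suc j)
    Wₓ = prefix W (≤-trans j<m (n≤1+n m))
    Dₓ = dist G Wₓ

  nbhd' : ∀ {j} → j ≤ m → ∀ {z} → E G (q j) z → z ≡ q (suc j) ⊎ ∃ λ t → j ≡ suc t × z ≡ q t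
  nbhd' {zero} _ e = inj₁ (deg≤1⇒unique-neighbour G (≤-reflexive deg-w) e (vertexAt-edge W (s≤s z≤n)))
  nbhd' {suc j} j<m e with deg≤2⇒two-neighbours G (inner-deg≤2 j<m) (vertexAt-edge W (s≤s j<m))
                             (E-sym simple (vertexAt-edge W (≤-trans j<m (n≤1+n m))))
                             (geodesic-no-return W shortest (s≤s j<m) ∘ sym) e
  ... | inj₁ z≡next = inj₁ z≡next
  ... | inj₂ z≡prev = inj₂ (j , refl , z≡prev)

  leg : Leg G u m
  leg = record { vertex = q ; end = vertexAt-last W ; edge = λ j≤m → vertexAt-edge W (s≤s j≤m) ; nbhd = nbhd' }

module _ {n} {G : Graph n} {u m} (L : Leg G u m) where

  leg-avoids-minDeg2 : (X : Fin n → Set) →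
                       (∀ {c} → X c → ∃₂ λ c₁ c₂ → c₁ ≢ c₂ × E G c c₁ × E G c c₂ × X c₁ × X c₂) →
                       ∀ {j} → j ≤ m → ¬ X (vertex L j)
  leg-avoids-minDeg2 X minDeg2 j≤m Xq with minDeg2 Xq
  ... | c₁ , c₂ , c₁≢c₂ , e₁ , e₂ , X₁ , X₂ with nbhd L j≤m e₁ | nbhd L j≤m e₂
  ... | inj₁ p | inj₁ r = c₁≢c₂ (trans p (sym r))
  ... | inj₂ (t , refl , refl) | _ = leg-avoids-minDeg2 X minDeg2 (≤-trans (n≤1+n t) j≤m) X₁
  ... | inj₁ _ | inj₂ (t , refl , refl) = leg-avoids-minDeg2 X minDeg2 (≤-trans (n≤1+n t) j≤m) X₂

  leg-coloured : IsSimple G → ∀ {S B} (D : Derivable G S B) {j} → j ≤ m → vertex L j ∈ₛ B →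
                 (∃ λ t → t ≤ m × vertex L t ∈ₛ S) ⊎ Forces D u (vertex L m)
  leg-coloured _ init j≤m q∈S = inj₁ (_ , j≤m , q∈S)
  leg-coloured simple (force b w D b∈ _ e _) j≤m q∈ with ∈-insert⁻ w q∈
  ... | inj₂ q∈B = Data.Sum.map₂ inj₂ (leg-coloured simple D j≤m q∈B)
  ... | inj₁ refl with nbhd L j≤m (E-sym simple e)
  ...   | inj₂ (t , refl , refl) = Data.Sum.map₂ inj₂ (leg-coloured simple D (≤-trans (n≤1+n t) j≤m) b∈)
  ...   | inj₁ refl with m≤n⇒m<n∨m≡n j≤m
  ...     | inj₁ j<m = Data.Sum.map₂ inj₂ (leg-coloured simple D j<m b∈)
  ...     | inj₂ refl = inj₂ (inj₁ (sym (end L) , refl))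

  leg-forcing : ∀ {S B} → Derivable G S B → vertex L 0 ∈ₛ B →
                ∃ λ B' → Derivable G S B' × B ⊆ B' × (∀ {t} → t ≤ suc m → vertex L t ∈ₛ B')
  leg-forcing {S} {B} D q₀∈B = upTo (suc m) ≤-refl
    where
    upTo : ∀ j → j ≤ suc m → ∃ λ B' → Derivable G S B' × B ⊆ B' × (∀ {t} → t ≤ j → vertex L t ∈ₛ B')
    upTo zero _ = B , D , (λ x∈ → x∈) , λ { z≤n → q₀∈B }
    upTo (suc j) j<1+m with upTo j (≤-trans (n≤1+n j) j<1+m)
    ... | B' , D' , B⊆B' , black = extend (vertex L (suc j) ∈? B')
      where
      j≤m = ≤-pred j<1+m
      black-upTo : ∀ {B''} → B' ⊆ B'' → vertex L (suc j) ∈ₛ B'' → ∀ {t} → t ≤ suc j → vertex L t ∈ₛ B''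
      black-upTo B'⊆ next∈ t≤ with m≤n⇒m<n∨m≡n t≤
      ... | inj₁ t<1+j = B'⊆ (black (≤-pred t<1+j))
      ... | inj₂ refl = next∈
      others-black : ∀ x → E G (vertex L j) x → x ≢ vertex L (suc j) → x ∈ₛ B'
      others-black x e x≢next with nbhd L j≤m e
      ... | inj₁ x≡next = ⊥-elim (x≢next x≡next)
      ... | inj₂ (t , refl , refl) = black (n≤1+n t)
      extend : Dec (vertex L (suc j) ∈ₛ B') →
               ∃ λ B'' → Derivable G S B'' × B ⊆ B'' × (∀ {t} → t ≤ suc j → vertex L t ∈ₛ B'')
      extend (yes next∈) = B' , D' , B⊆B' , black-upTo (λ x∈ → x∈) next∈
      extend (no next∉) =
        B' [ vertex L (suc j) ]≔ inside ,
        force (vertex L j) (vertex L (suc j)) D' (black ≤-refl) next∉ (edge L j≤m) others-black ,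
        ∈-insert⁺ _ ∘ B⊆B' , black-upTo (∈-insert⁺ _) ([]≔-updates B' _)

leg-deleteEdge : ∀ {n} {G : Graph n} {u m} v (L : Leg G u m) →
                 (∀ {j} → j ≤ m → vertex L j ≢ u) → (∀ {j} → j ≤ m → vertex L j ≢ v) →
                 Leg (deleteEdge G u v) u m
leg-deleteEdge {G = G} {u} v L ≢u ≢v = record
  { vertex = vertex L
  ; end = end L
  ; edge = λ j≤m → deleteEdge-keeps G u v (edge L j≤m) (≢u j≤m ∘ proj₁) (≢v j≤m ∘ proj₁)
  ; nbhd = λ j≤m e → nbhd L j≤m (deleteEdge-⊆ G u v e)
  }

module _ {n} {G : Graph n} {C : List (Fin n)} where

  cycle-leg : IsSimple G → IsCycle G C → ∀ {u w} → u ∈ C → Terminal G u w → ∀ {d} → Walk (E G) w u d →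
              ∃ λ m → Σ (Leg G u m) λ L → ∀ {j} → j ≤ m → vertex L j ∉ C
  cycle-leg simple cycle u∈C terminal@(deg-w , _) W with cycle-minDeg2 simple cycle u∈C
  ... | a , b , a≢b , ua , ub , _
    with terminal-leg simple terminal (λ { refl → a≢b (deg≤1⇒unique-neighbour G (≤-reflexive deg-w) ua ub) }) W
  ... | m , L = m , L , leg-avoids-minDeg2 L (_∈ C) (cycle-minDeg2 simple cycle)

ZNonIncreasing : ∀ {n} → Graph n → Fin n → Fin n → Set
ZNonIncreasing G u v = ∀ k k' → IsZ G k → IsZ (deleteEdge G u v) k' → k' ≤ k

module _ {n} {G : Graph n} {S₀ : Subset n} (Z₀ : ZeroForcing G S₀)
         (minimum : ∀ S → ZeroForcing G S → ∣ S₀ ∣ ≤ ∣ S ∣) (u v : Fin n) where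

  simulation⇒ZNonIncreasing : ∀ {S' B₀} → Derivable (deleteEdge G u v) S' B₀ → S₀ ⊆ B₀ → ∣ S' ∣ ≤ ∣ S₀ ∣ →
                              ¬ Forces Z₀ u v → (Forces Z₀ v u → u ∈ₛ B₀) → ZNonIncreasing G u v
  simulation⇒ZNonIncreasing D₀ S₀⊆B₀ ∣S'∣≤ ¬uv vu⇒u∈ _ _ ((Sₖ , Zₖ , refl) , _) (_ , minimum') =
    ≤-trans (minimum' _ (deleteEdge-zeroForcing G u v D₀ S₀⊆B₀ Z₀ ¬uv vu⇒u∈)) (≤-trans ∣S'∣≤ (minimum Sₖ Zₖ))

  -- Move the initial black vertex of the leg to its leaf: in G - uv the leaf then forces the whole leg and u.
  coloured-leg⇒ZNonIncreasing : ∀ {m} (L : Leg G u m) → (∀ {j} → j ≤ m → vertex L j ≢ u) →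
                                (∀ {j} → j ≤ m → vertex L j ≢ v) → ∀ {t} → t ≤ m → vertex L t ∈ₛ S₀ →
                                ¬ Forces Z₀ u v → ZNonIncreasing G u v
  coloured-leg⇒ZNonIncreasing {m} L ≢u ≢v {t} t≤m qₜ∈S₀ ¬uv =
    conclude (leg-forcing (leg-deleteEdge v L ≢u ≢v) init ([]≔-updates _ (vertex L 0)))
    where
    S' = (S₀ - vertex L t) [ vertex L 0 ]≔ inside
    conclude : (∃ λ B₀ → Derivable (deleteEdge G u v) S' B₀ × S' ⊆ B₀ × (∀ {j} → j ≤ suc m → vertex L j ∈ₛ B₀)) →
               ZNonIncreasing G u v
    conclude (B₀ , D₀ , S'⊆B₀ , black) =
      simulation⇒ZNonIncreasing D₀ S₀⊆B₀ (≤-trans (∣insert∣≤1+∣p∣ (S₀ - vertex L t) (vertex L 0)) (x∈p⇒∣p-x∣<∣p∣ qₜ∈S₀)) ¬uv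
                                (λ _ → subst (_∈ₛ B₀) (end L) (black ≤-refl))
      where
      S₀⊆B₀ : S₀ ⊆ B₀
      S₀⊆B₀ {x} x∈S₀ with x ≟ vertex L t
      ... | yes refl = black (≤-trans t≤m (n≤1+n m))
      ... | no x≢qₜ = S'⊆B₀ (∈-insert⁺ _ (x∈p∧x≢y⇒x∈p-y x∈S₀ x≢qₜ))

leg-ZNonIncreasing : ∀ {n} {G : Graph n} {u m} → IsSimple G → (L : Leg G u m) → (∀ {j} → j ≤ m → vertex L j ≢ u) →
                     ∀ {a b} → a ≢ b → (∀ {j v} → j ≤ m → v ≡ a ⊎ v ≡ b → vertex L j ≢ v) →
                     ∃ λ v → (v ≡ a ⊎ v ≡ b) × ZNonIncreasing G u v
leg-ZNonIncreasing {G = G} {u} {m} simple L ≢u {a} a≢b ≢ab with Z-exists G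
... | _ , (S₀ , Z₀ , refl) , minimum with forces? Z₀ u (vertex L m) | leg-coloured L simple Z₀ z≤n ∈⊤
...   | yes u→qₘ | _ =
  let v , v∈ab , ¬vu = one-of-two a≢b (forces-injective Z₀) (forces? Z₀ a u)
  in v , v∈ab , simulation⇒ZNonIncreasing Z₀ minimum u v init (λ x∈ → x∈) ≤-refl
                  (λ uv → ≢ab ≤-refl v∈ab (forces-functional Z₀ u→qₘ uv)) (⊥-elim ∘ ¬vu)
...   | no ¬u→qₘ | inj₂ u→qₘ = ⊥-elim (¬u→qₘ u→qₘ)
...   | no _ | inj₁ (t , t≤m , qₜ∈S₀) =
  let v , v∈ab , ¬uv = one-of-two a≢b (forces-functional Z₀) (forces? Z₀ u a)
  in v , v∈ab , coloured-leg⇒ZNonIncreasing Z₀ minimum u v L ≢u (λ j≤m → ≢ab j≤m v∈ab) t≤m qₜ∈S₀ ¬uv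

lemma26 : ∀ {n} (G : Graph n) (C : List (Fin n)) → IsSimple G → Connected G →
    UniqueCycle G C → length C % 2 ≡ 1 →
    ∀ (u : Fin n) → u ∈ C → ℓ≥1 G C u →
    ∃ λ (v : Fin n) → CycEdge C u v ×
      (∀ (k k' : ℕ) → IsZ G k → IsZ (deleteEdge G u v) k' → k' ≤ k)
lemma26 G C simple connected (cycle@(3≤ , uniq , _) , _) _ u u∈C (_ , w , terminal)
  with cycle-neighbours 3≤ uniq u∈C | cycle-leg simple cycle u∈C terminal (proj₂ (connected w u))
... | a , b , a≢b , ua , ub | m , L , L∉C
  with leg-ZNonIncreasing simple L (λ j≤m → ∉⇒≢ (L∉C j≤m) u∈C) a≢b off-ab
  where
  off-ab : ∀ {j v} → j ≤ m → v ≡ a ⊎ v ≡ b → vertex L j ≢ v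
  off-ab j≤m (inj₁ refl) = ∉⇒≢ (L∉C j≤m) (cycEdge-∈ ua)
  off-ab j≤m (inj₂ refl) = ∉⇒≢ (L∉C j≤m) (cycEdge-∈ ub)
... | v , inj₁ refl , Z≤ = v , ua , Z≤
... | v , inj₂ refl , Z≤ = v , ub , Z≤
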